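{- Let $q=p^m$ be a prime power and let $\mathbb{F}_q$ be the finite field with $q$ elements. Let $A\subset\mathbb{F}_q$ and $B\subset\mathbb{F}_q$ be such that $B$ is symmetric, i.e. $B=-B$, and $|A||B|>q$. Then $8AB=\mathbb{F}_q$.
   Context: For $X,Y\subset\mathbb{F}_q$, $XY=\{xy: x\in X, y\in Y\}$, and for a natural number $k$, $kX=\{x_1+\dots+x_k: x_1,\dots,x_k\in X\}$; thus $8AB$ is the set of all sums of $8$ elements of $AB$. Also $-B=\{ -b:b\in B\}$. -}

module Defs where

open import Level using (0ℓ)
open import Data.Nat using (ℕ; zero; suc)
open import Data.Fin using (Fin; zero; suc)
open import Data.Fin.Subset using (Subset; _∈_)
open import Data.Product using (Σ; ∃; _×_)
open import Relation.Binary.PropositionalEquality using (_≡_; _≢_)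
open import Algebra.Structures using (IsCommutativeRing)

-- A finite field with q elements, with carrier Fin q (every finite field
-- is isomorphic to one of this form) and propositional equality.
record FiniteField (q : ℕ) : Set where
  infixl 6 _+_
  infixl 7 _*_
  field
    _+_ _*_ : Fin q → Fin q → Fin q
    -_      : Fin q → Fin q
    0# 1#   : Fin q
    isCommutativeRing : IsCommutativeRing _≡_ _+_ _*_ -_ 0# 1#
    0≢1     : 0# ≢ 1#
    inverse : ∀ x → x ≢ 0# → ∃ λ y → x * y ≡ 1#

module _ {q : ℕ} (F : FiniteField q) where
  open FiniteField F

  Σ[_] : {k : ℕ} → (Fin k → Fin q) → Fin q
  Σ[_] {zero}  f = 0#
  Σ[_] {suc k} f = f zero + Σ[_] (λ i → f (suc i))

  InKAB : ℕ → Subset q → Subset q → Fin q → Set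
  InKAB k A B x =
    Σ (Fin k → Fin q) λ a → Σ (Fin k → Fin q) λ b →
      (∀ i → a i ∈ A) × (∀ i → b i ∈ B) × (x ≡ Σ[_] (λ i → a i * b i))

  Symmetric : Subset q → Set
  Symmetric B = ∀ b → b ∈ B → (- b) ∈ B

-- Put N = |A||B| > q and, for ξ ∈ F_q, let h_ξ(a, b) = a + ξb on A × B.  For a
-- map h on A × B write E(h) for its energy, the number of pairs with equal images.
--  (1) Two distinct points of A × B are identified by h_ξ for at most one ξ, so
--      Σ_ξ E(h_ξ) ≤ N² + qN and some ξ has q·E(h_ξ) ≤ qN + N².
--  (2) As N > q, h_ξ is not injective: a + ξb = a' + ξb' with b ≠ b', so
--      u = b' − b ≠ 0 and ξu = a − a'.
--  (3) By Cauchy–Schwarz N² ≤ |A + ξB|·E(h_ξ), and likewise for any translate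
--      y + (A + ξB), which has the same energy; if the two were disjoint then
--      2N² ≤ q·E(h_ξ) ≤ qN + N², i.e. N ≤ q.  So y + (a₁ + ξb₁) = a₂ + ξb₂.
--  (4) For y = x/u this gives x = uy = (a₂ − a₁)(b' − b) + (a − a')(b₂ − b₁),
--      a sum of eight products from AB because B = −B.
module Submission where

open import Defs

open import Data.Nat using (ℕ; zero; suc; _≤_; _<_; z≤n; s≤s)
open import Data.Fin using (Fin; zero; suc; _≟_)
open import Data.Fin.Subset using (Subset; _∈_; ∣_∣)
open import Data.Product using (∃; ∃₂; _×_; _,_; proj₁; proj₂)
open import Data.Sum using (_⊎_; inj₁; inj₂)
open import Data.Empty using (⊥-elim)
open import Relation.Nullary using (¬_; yes; no; contradiction; _×-dec_)
open import Relation.Binary.PropositionalEquality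
  using (_≡_; _≢_; refl; sym; trans; cong; cong₂; subst; subst₂; module ≡-Reasoning)
open import Algebra.Bundles using (CommutativeRing)

module Counting where
  open import Data.Nat using (_+_; _*_; _≤?_; _<?_)
  open import Data.Nat.Properties
    using (+-*-semiring; ≤-refl; ≤-trans; ≤-reflexive; ≤-total; ≤-pred; <⇒≱; ≰⇒>; ≮⇒≥;
           m≤m+n; m≤n+m; m≤n⇒∃[o]m+o≡n; +-comm; +-identityʳ; +-mono-≤; +-monoˡ-<;
           +-cancelʳ-≤; *-comm; *-zeroʳ; *-identityˡ; *-identityʳ; *-suc; *-distribʳ-+;
           *-mono-≤; *-monoʳ-≤; *-monoˡ-≤; *-cancelˡ-≤; *-cancelʳ-≤; module ≤-Reasoning)
  open import Data.Nat.Solver using (module +-*-Solver)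
  open import Algebra.Properties.Semiring.Sum +-*-semiring
    using (sum; sum-cong-≗; ∑-distrib-+; ∑-comm; *-distribˡ-sum; *-distribʳ-sum)
  open import Data.Fin.Properties using (any?; suc-injective)
  open import Data.Product.Properties using (≡-dec)
  open import Data.Vec.Base using ([]; _∷_; lookup; here; there)
  open import Data.Bool.Base using (true; false; if_then_else_)

  sum-mono : ∀ {n} {f g : Fin n → ℕ} → (∀ i → f i ≤ g i) → sum f ≤ sum g
  sum-mono {zero}  f≤g = z≤n
  sum-mono {suc n} f≤g = +-mono-≤ (f≤g zero) (sum-mono (λ i → f≤g (suc i)))

  sum-const : ∀ n c → sum {n} (λ _ → c) ≡ n * c
  sum-const zero    c = refl
  sum-const (suc n) c = cong (c +_) (sum-const n c)

  sum-≤-length : ∀ {n} (f : Fin n → ℕ) → (∀ i → f i ≤ 1) → sum f ≤ n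
  sum-≤-length {n} f f≤1 =
    ≤-trans (sum-mono f≤1) (≤-reflexive (trans (sum-const n 1) (*-identityʳ n)))

  sum-positive : ∀ {n} (f : Fin n → ℕ) → 0 < sum f → ∃ λ i → 0 < f i
  sum-positive {suc n} f p with f zero in f0≡
  ... | suc _ = zero , subst (0 <_) (sym f0≡) (s≤s z≤n)
  ... | zero  with sum-positive (λ i → f (suc i)) p
  ...   | i , fi>0 = suc i , fi>0

  sum-two : ∀ {n} (f : Fin n → ℕ) → 2 ≤ sum f →
    (∃ λ i → 2 ≤ f i) ⊎ (∃₂ λ i j → i ≢ j × 0 < f i × 0 < f j)
  sum-two {suc n} f p with f zero in f0≡
  ... | suc (suc _) = inj₁ (zero , subst (2 ≤_) (sym f0≡) (s≤s (s≤s z≤n)))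
  ... | suc zero with sum-positive (λ i → f (suc i)) (≤-pred p)
  ...   | j , fj>0 = inj₂ (zero , suc j , (λ ()) , subst (0 <_) (sym f0≡) (s≤s z≤n) , fj>0)
  sum-two {suc n} f p | zero with sum-two (λ i → f (suc i)) p
  ...   | inj₁ (i , fi≥2) = inj₁ (suc i , fi≥2)
  ...   | inj₂ (i , j , i≢j , fi>0 , fj>0) =
            inj₂ (suc i , suc j , (λ e → i≢j (suc-injective e)) , fi>0 , fj>0)

  sum-at-most-one : ∀ {n} (f : Fin n → ℕ) → (∀ i → f i ≤ 1) →
    (∀ i j → 0 < f i → 0 < f j → i ≡ j) → sum f ≤ 1
  sum-at-most-one {zero}  f f≤1 unique = z≤n
  sum-at-most-one {suc n} f f≤1 unique with f zero in f0≡
  ... | zero = sum-at-most-one (λ i → f (suc i)) (λ i → f≤1 (suc i))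
                 (λ i j p r → suc-injective (unique (suc i) (suc j) p r))
  ... | suc k = +-mono-≤ (subst (_≤ 1) f0≡ (f≤1 zero)) rest≤0
    where
    rest≤0 : sum (λ i → f (suc i)) ≤ 0
    rest≤0 = ≤-trans (sum-mono (λ i → ≮⇒≥ (λ fi>0 →
               contradiction (unique zero (suc i) (subst (0 <_) (sym f0≡) (s≤s z≤n)) fi>0) λ ())))
             (≤-reflexive (trans (sum-const n 0) (*-zeroʳ n)))

  sum-average : ∀ {n} (f : Fin n → ℕ) (T : ℕ) → 0 < n → sum f ≤ T → ∃ λ i → n * f i ≤ T
  sum-average {n} f T n>0 sum≤T with any? (λ i → n * f i ≤? T)
  ... | yes small = small
  ... | no ¬small = ⊥-elim (<⇒≱ nT<∑ (*-monoʳ-≤ n sum≤T))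
    where
    open ≤-Reasoning
    nT<∑ : n * T < n * sum f
    nT<∑ = begin-strict
      n * T                  <⟨ +-monoˡ-< (n * T) n>0 ⟩
      n + n * T              ≡⟨ *-suc n T ⟨
      n * suc T              ≡⟨ sum-const n (suc T) ⟨
      sum {n} (λ _ → suc T)  ≤⟨ sum-mono (λ i → ≰⇒> (λ le → ¬small (i , le))) ⟩
      sum (λ i → n * f i)    ≡⟨ *-distribˡ-sum n f ⟨
      n * sum f              ∎

  ∑₂ : ∀ {k l} → (Fin k → Fin l → ℕ) → ℕ
  ∑₂ f = sum (λ a → sum (λ b → f a b))

  ∑₂-cong : ∀ {k l} {f g : Fin k → Fin l → ℕ} → (∀ a b → f a b ≡ g a b) → ∑₂ f ≡ ∑₂ g
  ∑₂-cong f≡g = sum-cong-≗ (λ a → sum-cong-≗ (f≡g a))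

  ∑₂-mono : ∀ {k l} {f g : Fin k → Fin l → ℕ} → (∀ a b → f a b ≤ g a b) → ∑₂ f ≤ ∑₂ g
  ∑₂-mono f≤g = sum-mono (λ a → sum-mono (f≤g a))

  ∑₂-+ : ∀ {k l} (f g : Fin k → Fin l → ℕ) → ∑₂ (λ a b → f a b + g a b) ≡ ∑₂ f + ∑₂ g
  ∑₂-+ f g = trans (sum-cong-≗ (λ a → ∑-distrib-+ (f a) (g a)))
                   (∑-distrib-+ (λ a → sum (f a)) (λ a → sum (g a)))

  ∑₂-*ˡ : ∀ {k l} c (f : Fin k → Fin l → ℕ) → ∑₂ (λ a b → c * f a b) ≡ c * ∑₂ f
  ∑₂-*ˡ c f = sym (trans (*-distribˡ-sum c (λ a → sum (f a)))
                         (sum-cong-≗ (λ a → *-distribˡ-sum c (f a))))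

  ∑₂-swap : ∀ {m k l} (f : Fin m → Fin k → Fin l → ℕ) →
    sum (λ z → ∑₂ (f z)) ≡ ∑₂ (λ a b → sum (λ z → f z a b))
  ∑₂-swap f = trans (∑-comm (λ z a → sum (f z a))) (sum-cong-≗ (λ a → ∑-comm (λ z → f z a)))

  sum-product : ∀ {k l} (f : Fin k → ℕ) (g : Fin l → ℕ) → sum f * sum g ≡ ∑₂ (λ i j → f i * g j)
  sum-product f g = trans (*-distribʳ-sum (sum g) f) (sum-cong-≗ (λ i → *-distribˡ-sum (f i) g))

  ∑₄ : ∀ {k l} → (Fin k → Fin l → Fin k → Fin l → ℕ) → ℕ
  ∑₄ f = ∑₂ (λ a b → ∑₂ (f a b))

  ∑₄-cong : ∀ {k l} {f g : Fin k → Fin l → Fin k → Fin l → ℕ} →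
    (∀ a b a' b' → f a b a' b' ≡ g a b a' b') → ∑₄ f ≡ ∑₄ g
  ∑₄-cong f≡g = ∑₂-cong (λ a b → ∑₂-cong (f≡g a b))

  ∑₄-mono : ∀ {k l} {f g : Fin k → Fin l → Fin k → Fin l → ℕ} →
    (∀ a b a' b' → f a b a' b' ≤ g a b a' b') → ∑₄ f ≤ ∑₄ g
  ∑₄-mono f≤g = ∑₂-mono (λ a b → ∑₂-mono (f≤g a b))

  ∑₄-+ : ∀ {k l} (f g : Fin k → Fin l → Fin k → Fin l → ℕ) →
    ∑₄ (λ a b a' b' → f a b a' b' + g a b a' b') ≡ ∑₄ f + ∑₄ g
  ∑₄-+ f g = trans (∑₂-cong (λ a b → ∑₂-+ (f a b) (g a b)))
                   (∑₂-+ (λ a b → ∑₂ (f a b)) (λ a b → ∑₂ (g a b)))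

  ∑₄-*ˡ : ∀ {k l} c (f : Fin k → Fin l → Fin k → Fin l → ℕ) →
    ∑₄ (λ a b a' b' → c * f a b a' b') ≡ c * ∑₄ f
  ∑₄-*ˡ c f = trans (∑₂-cong (λ a b → ∑₂-*ˡ c (f a b))) (∑₂-*ˡ c (λ a b → ∑₂ (f a b)))

  ∑₄-swap : ∀ {m k l} (f : Fin m → Fin k → Fin l → Fin k → Fin l → ℕ) →
    sum (λ z → ∑₄ (f z)) ≡ ∑₄ (λ a b a' b' → sum (λ z → f z a b a' b'))
  ∑₄-swap f = trans (∑₂-swap (λ z a b → ∑₂ (f z a b)))
                    (∑₂-cong (λ a b → ∑₂-swap (λ z → f z a b)))

  ∑₂-product : ∀ {k l} (f g : Fin k → Fin l → ℕ) →
    ∑₂ f * ∑₂ g ≡ ∑₄ (λ a b a' b' → f a b * g a' b')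
  ∑₂-product f g = trans (*-distribʳ-sum (∑₂ g) (λ a → sum (f a)))
    (sum-cong-≗ (λ a → trans (*-distribʳ-sum (∑₂ g) (f a))
                             (sum-cong-≗ (λ b → sym (∑₂-*ˡ (f a b) g)))))

  sgn : ℕ → ℕ
  sgn zero    = 0
  sgn (suc _) = 1

  sgn≤1 : ∀ n → sgn n ≤ 1
  sgn≤1 zero    = z≤n
  sgn≤1 (suc _) = s≤s z≤n

  sgn-disjoint : ∀ m n → ¬ (0 < m × 0 < n) → sgn m + sgn n ≤ 1
  sgn-disjoint zero    n       _        = sgn≤1 n
  sgn-disjoint (suc m) zero    _        = s≤s z≤n
  sgn-disjoint (suc m) (suc n) not-both = ⊥-elim (not-both (s≤s z≤n , s≤s z≤n))

  -- The arithmetic–geometric mean inequality 2mn ≤ m² + n², first for m ≤ n,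
  -- where n = m + d and the difference of the two sides is d².
  am-gm-ordered : ∀ {m n} → m ≤ n → 2 * (m * n) ≤ m * m + n * n
  am-gm-ordered {m} m≤n with m≤n⇒∃[o]m+o≡n m≤n
  ... | d , refl = subst (2 * (m * (m + d)) ≤_) square-of-difference (m≤m+n _ (d * d))
    where
    open +-*-Solver
    square-of-difference : 2 * (m * (m + d)) + d * d ≡ m * m + (m + d) * (m + d)
    square-of-difference =
      solve 2 (λ m d → con 2 :* (m :* (m :+ d)) :+ d :* d := m :* m :+ (m :+ d) :* (m :+ d)) refl m d

  am-gm : ∀ m n → 2 * (m * n) ≤ m * m + n * n
  am-gm m n with ≤-total m n
  ... | inj₁ m≤n = am-gm-ordered m≤n
  ... | inj₂ n≤m = subst₂ _≤_ (cong (2 *_) (*-comm n m)) (+-comm (n * n) (m * m)) (am-gm-ordered n≤m)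

  -- The pointwise inequality behind Cauchy–Schwarz on the support.
  am-gm-support : ∀ m n → 2 * (m * n) ≤ sgn m * (n * n) + sgn n * (m * m)
  am-gm-support zero    n       = z≤n
  am-gm-support (suc m) zero    = ≤-reflexive (cong (2 *_) (*-zeroʳ (suc m)))
  am-gm-support (suc m) (suc n) =
    subst₂ _≤_ (cong (2 *_) (*-comm (suc n) (suc m)))
               (sym (cong₂ _+_ (*-identityˡ (suc n * suc n)) (*-identityˡ (suc m * suc m))))
               (am-gm (suc n) (suc m))

  cauchy-schwarz : ∀ {n} (f : Fin n → ℕ) →
    sum f * sum f ≤ sum (λ i → sgn (f i)) * sum (λ i → f i * f i)
  cauchy-schwarz f = *-cancelˡ-≤ 2 (begin
      2 * (sum f * sum f)
    ≡⟨ cong (2 *_) (sum-product f f) ⟩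
      2 * ∑₂ (λ i j → f i * f j)
    ≡⟨ ∑₂-*ˡ 2 (λ i j → f i * f j) ⟨
      ∑₂ (λ i j → 2 * (f i * f j))
    ≤⟨ ∑₂-mono (λ i j → am-gm-support (f i) (f j)) ⟩
      ∑₂ (λ i j → sgn (f i) * (f j * f j) + sgn (f j) * (f i * f i))
    ≡⟨ ∑₂-+ (λ i j → sgn (f i) * (f j * f j)) (λ i j → sgn (f j) * (f i * f i)) ⟩
      ∑₂ (λ i j → sgn (f i) * (f j * f j)) + ∑₂ (λ i j → sgn (f j) * (f i * f i))
    ≡⟨ cong (∑₂ (λ i j → sgn (f i) * (f j * f j)) +_) (∑-comm (λ i j → sgn (f j) * (f i * f i))) ⟩
      ∑₂ (λ i j → sgn (f i) * (f j * f j)) + ∑₂ (λ i j → sgn (f i) * (f j * f j))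
    ≡⟨ cong (λ t → t + t) (sum-product (λ i → sgn (f i)) (λ j → f j * f j)) ⟨
      S * Q + S * Q
    ≡⟨ cong (S * Q +_) (+-identityʳ (S * Q)) ⟨
      2 * (S * Q)
    ∎)
    where
    open ≤-Reasoning
    S = sum (λ i → sgn (f i))
    Q = sum (λ i → f i * f i)

  -- The counting contradiction: two sets of sizes S₁, S₂ with N² ≤ Sᵢ·E cannot lie
  -- disjointly in n points when n·E ≤ nN + N², unless N ≤ n.
  no-room : ∀ {N n S₁ S₂ E} → N * N ≤ S₁ * E → N * N ≤ S₂ * E → S₁ + S₂ ≤ n →
    n * E ≤ n * N + N * N → N ≤ n
  no-room {zero}        _  _  _  _ = z≤n
  no-room N@{suc _} {n} {S₁} {S₂} {E} N²≤S₁E N²≤S₂E S₁+S₂≤n nE≤ =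
    *-cancelʳ-≤ N n N (+-cancelʳ-≤ (N * N) (N * N) (n * N) (begin
      N * N + N * N    ≤⟨ +-mono-≤ N²≤S₁E N²≤S₂E ⟩
      S₁ * E + S₂ * E  ≡⟨ *-distribʳ-+ E S₁ S₂ ⟨
      (S₁ + S₂) * E    ≤⟨ *-monoˡ-≤ E S₁+S₂≤n ⟩
      n * E            ≤⟨ nE≤ ⟩
      n * N + N * N    ∎))
    where open ≤-Reasoning

  δ : ∀ {n} → Fin n → Fin n → ℕ
  δ u v with u ≟ v
  ... | yes _ = 1
  ... | no  _ = 0

  δ-refl : ∀ {n} (u : Fin n) → δ u u ≡ 1
  δ-refl u with u ≟ u
  ... | yes _  = refl
  ... | no u≢u = contradiction refl u≢u

  δ-≢ : ∀ {n} {u v : Fin n} → u ≢ v → δ u v ≡ 0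
  δ-≢ {u = u} {v} u≢v with u ≟ v
  ... | yes u≡v = contradiction u≡v u≢v
  ... | no  _   = refl

  δ-positive : ∀ {n} {u v : Fin n} → 0 < δ u v → u ≡ v
  δ-positive {u = u} {v} δ>0 with u ≟ v
  ... | yes u≡v = u≡v

  δ≤1 : ∀ {n} (u v : Fin n) → δ u v ≤ 1
  δ≤1 u v with u ≟ v
  ... | yes _ = s≤s z≤n
  ... | no  _ = z≤n

  δ-injective : ∀ {m n} (σ : Fin m → Fin n) → (∀ {u v} → σ u ≡ σ v → u ≡ v) →
    ∀ u v → δ (σ u) (σ v) ≡ δ u v
  δ-injective σ σ-inj u v with u ≟ v
  ... | yes refl = δ-refl (σ u)
  ... | no  u≢v  = δ-≢ (λ σu≡σv → u≢v (σ-inj σu≡σv))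

  sum-δ : ∀ {n} (g : Fin n → ℕ) (v : Fin n) → sum (λ z → g z * δ v z) ≡ g v
  sum-δ {suc n} g zero = begin
      g zero * δ {suc n} zero zero + sum (λ i → g (suc i) * δ zero (suc i))
    ≡⟨ cong₂ _+_ (cong (g zero *_) (δ-refl {suc n} zero)) off-centre ⟩
      g zero * 1 + 0
    ≡⟨ trans (+-identityʳ _) (*-identityʳ _) ⟩
      g zero
    ∎
    where
    open ≡-Reasoning
    off-centre : sum (λ i → g (suc i) * δ zero (suc i)) ≡ 0
    off-centre = trans (sum-cong-≗ vanishes) (trans (sum-const n 0) (*-zeroʳ n))
      where
      vanishes : ∀ i → g (suc i) * δ zero (suc i) ≡ 0
      vanishes i = trans (cong (g (suc i) *_) (δ-≢ {u = zero} {v = suc i} λ ())) (*-zeroʳ (g (suc i)))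
  sum-δ {suc n} g (suc v) = begin
      g zero * δ (suc v) zero + sum (λ i → g (suc i) * δ (suc v) (suc i))
    ≡⟨ cong₂ _+_ (trans (cong (g zero *_) (δ-≢ {u = suc v} {v = zero} λ ())) (*-zeroʳ (g zero)))
                 (sum-cong-≗ (λ i → cong (g (suc i) *_) (δ-injective suc suc-injective v i))) ⟩
      0 + sum (λ i → g (suc i) * δ v i)
    ≡⟨ sum-δ (λ i → g (suc i)) v ⟩
      g (suc v)
    ∎
    where open ≡-Reasoning

  𝟙 : ∀ {n} → Subset n → Fin n → ℕ
  𝟙 p x = if lookup p x then 1 else 0

  𝟙-positive : ∀ {n} (p : Subset n) x → 0 < 𝟙 p x → x ∈ p
  𝟙-positive (true  ∷ p) zero    _   = here
  𝟙-positive (s     ∷ p) (suc x) 𝟙>0 = there (𝟙-positive p x 𝟙>0)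

  𝟙≤1 : ∀ {n} (p : Subset n) x → 𝟙 p x ≤ 1
  𝟙≤1 (true  ∷ p) zero    = s≤s z≤n
  𝟙≤1 (false ∷ p) zero    = z≤n
  𝟙≤1 (s     ∷ p) (suc x) = 𝟙≤1 p x

  sum-𝟙 : ∀ {n} (p : Subset n) → sum (𝟙 p) ≡ ∣ p ∣
  sum-𝟙 []          = refl
  sum-𝟙 (true  ∷ p) = cong suc (sum-𝟙 p)
  sum-𝟙 (false ∷ p) = sum-𝟙 p

  product-positive : ∀ m n → 0 < m * n → 0 < m × 0 < n
  product-positive (suc m) zero    mn>0 = ⊥-elim (<⇒≱ mn>0 (≤-reflexive (*-zeroʳ (suc m))))
  product-positive (suc m) (suc n) _    = s≤s z≤n , s≤s z≤n

  box : ∀ {k l} → Subset k → Subset l → Fin k → Fin l → ℕ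
  box A B a b = 𝟙 A a * 𝟙 B b

  box≤1 : ∀ {k l} (A : Subset k) (B : Subset l) a b → box A B a b ≤ 1
  box≤1 A B a b = *-mono-≤ (𝟙≤1 A a) (𝟙≤1 B b)

  box-positive : ∀ {k l} (A : Subset k) (B : Subset l) {a b} → 0 < box A B a b → a ∈ A × b ∈ B
  box-positive A B {a} {b} positive with product-positive (𝟙 A a) (𝟙 B b) positive
  ... | 𝟙A>0 , 𝟙B>0 = 𝟙-positive A a 𝟙A>0 , 𝟙-positive B b 𝟙B>0

  box-weight : ∀ {k l} (A : Subset k) (B : Subset l) → ∑₂ (box A B) ≡ ∣ A ∣ * ∣ B ∣
  box-weight A B = trans (sym (sum-product (𝟙 A) (𝟙 B))) (cong₂ _*_ (sum-𝟙 A) (sum-𝟙 B))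

  -- The grid Fin k × Fin l carries a 0/1 weight w (in
  -- the application, the indicator of A × B).
  module WeightedGrid {k l : ℕ} (w : Fin k → Fin l → ℕ) (w≤1 : ∀ a b → w a b ≤ 1) where

    GridMap : ℕ → Set
    GridMap n = Fin k → Fin l → Fin n

    N : ℕ
    N = ∑₂ w

    count : ∀ {n} → GridMap n → Fin n → ℕ
    count h z = ∑₂ (λ a b → w a b * δ (h a b) z)

    image-size : ∀ {n} → GridMap n → ℕ
    image-size h = sum (λ z → sgn (count h z))

    energy : ∀ {n} → GridMap n → ℕ
    energy h = ∑₄ (λ a b a' b' → w a b * w a' b' * δ (h a b) (h a' b'))

    sum-count : ∀ {n} (h : GridMap n) → sum (count h) ≡ N
    sum-count h = trans (∑₂-swap (λ z a b → w a b * δ (h a b) z))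
                        (∑₂-cong (λ a b → sum-δ (λ _ → w a b) (h a b)))

    sum-count² : ∀ {n} (h : GridMap n) → sum (λ z → count h z * count h z) ≡ energy h
    sum-count² h = begin
        sum (λ z → count h z * count h z)
      ≡⟨ sum-cong-≗ (λ z → ∑₂-product (g z) (g z)) ⟩
        sum (λ z → ∑₄ (λ a b a' b' → g z a b * g z a' b'))
      ≡⟨ ∑₄-swap (λ z a b a' b' → g z a b * g z a' b') ⟩
        ∑₄ (λ a b a' b' → sum (λ z → g z a b * g z a' b'))
      ≡⟨ ∑₄-cong coincidences ⟩
        energy h
      ∎
      where
      open ≡-Reasoning
      open +-*-Solver
      g : Fin _ → Fin k → Fin l → ℕ
      g z a b = w a b * δ (h a b) z
      coincidences : ∀ a b a' b' →
        sum (λ z → g z a b * g z a' b') ≡ w a b * w a' b' * δ (h a b) (h a' b')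
      coincidences a b a' b' = trans
        (sum-cong-≗ (λ z → solve 4 (λ x d x' d' → (x :* d) :* (x' :* d') := (x :* x' :* d) :* d') refl
                                   (w a b) (δ (h a b) z) (w a' b') (δ (h a' b') z)))
        (sum-δ (λ z → w a b * w a' b' * δ (h a b) z) (h a' b'))

    energy-image-bound : ∀ {n} (h : GridMap n) → N * N ≤ image-size h * energy h
    energy-image-bound h =
      subst₂ (λ s t → s * s ≤ image-size h * t) (sum-count h) (sum-count² h) (cauchy-schwarz (count h))

    energy-injective : ∀ {n n'} (h : GridMap n) (σ : Fin n → Fin n') →
      (∀ {u v} → σ u ≡ σ v → u ≡ v) → energy (λ a b → σ (h a b)) ≡ energy h
    energy-injective h σ σ-inj = ∑₄-cong (λ a b a' b' →
      cong (w a b * w a' b' *_) (δ-injective σ σ-inj (h a b) (h a' b')))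

    fibre-point : ∀ {n} (h : GridMap n) z a b → 0 < w a b * δ (h a b) z → 0 < w a b × h a b ≡ z
    fibre-point h z a b positive with product-positive (w a b) (δ (h a b) z) positive
    ... | w>0 , δ>0 = w>0 , δ-positive δ>0

    count-witness : ∀ {n} (h : GridMap n) z → 0 < count h z → ∃₂ λ a b → 0 < w a b × h a b ≡ z
    count-witness h z positive with sum-positive _ positive
    ... | a , row>0 with sum-positive _ row>0
    ...   | b , point>0 = a , b , fibre-point h z a b point>0

    record Collision {n} (h : GridMap n) : Set where
      field
        a a'     : Fin k
        b b'     : Fin l
        weighted  : 0 < w a b
        weighted' : 0 < w a' b'
        distinct  : (a , b) ≢ (a' , b')
        collide   : h a b ≡ h a' b'

    fibre-collision : ∀ {n} (h : GridMap n) z a b a' b' → (a , b) ≢ (a' , b') →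
      0 < w a b * δ (h a b) z → 0 < w a' b' * δ (h a' b') z → Collision h
    fibre-collision h z a b a' b' distinct p p' with fibre-point h z a b p | fibre-point h z a' b' p'
    ... | w>0 , hab≡z | w'>0 , ha'b'≡z = record
      { a = a ; a' = a' ; b = b ; b' = b' ; weighted = w>0 ; weighted' = w'>0
      ; distinct = distinct ; collide = trans hab≡z (sym ha'b'≡z) }

    crowded-fibre : ∀ {n} (h : GridMap n) z → 2 ≤ count h z → Collision h
    crowded-fibre h z crowded with sum-two (λ a → sum (λ b → w a b * δ (h a b) z)) crowded
    ... | inj₁ (a , row≥2) with sum-two (λ b → w a b * δ (h a b) z) row≥2
    ...   | inj₁ (b , point≥2) = ⊥-elim (<⇒≱ point≥2 (*-mono-≤ (w≤1 a b) (δ≤1 (h a b) z)))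
    ...   | inj₂ (b , b' , b≢b' , p , p') = fibre-collision h z a b a b' (λ e → b≢b' (cong proj₂ e)) p p'
    crowded-fibre h z crowded | inj₂ (a , a' , a≢a' , p , p')
      with sum-positive _ p | sum-positive _ p'
    ... | b , q | b' , q' = fibre-collision h z a b a' b' (λ e → a≢a' (cong proj₁ e)) q q'

    pigeonhole : ∀ {n} (h : GridMap n) → n < N → Collision h
    pigeonhole {n} h n<N with any? (λ z → 2 ≤? count h z)
    ... | yes (z , crowded) = crowded-fibre h z crowded
    ... | no  ¬crowded      =
      ⊥-elim (<⇒≱ n<N (subst (_≤ n) (sum-count h) (sum-≤-length (count h) sparse)))
      where
      sparse : ∀ z → count h z ≤ 1
      sparse z = ≤-pred (≰⇒> (λ crowded → ¬crowded (z , crowded)))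

    LowEnergy : ∀ {n} → ℕ → GridMap n → Set
    LowEnergy m h = m * energy h ≤ m * N + N * N

    -- Two maps of equal, small energy have overlapping images: each image has
    -- size at least N²/E, so disjoint images would not fit into Fin n.
    images-meet : ∀ {n} (h₁ h₂ : GridMap n) → energy h₂ ≡ energy h₁ →
      LowEnergy n h₁ → n < N → ∃ λ z → 0 < count h₁ z × 0 < count h₂ z
    images-meet {n} h₁ h₂ E₂≡E₁ low n<N
      with any? (λ z → (0 <? count h₁ z) ×-dec (0 <? count h₂ z))
    ... | yes common  = common
    ... | no disjoint = ⊥-elim (<⇒≱ n<N (no-room {S₁ = image-size h₁} {image-size h₂}
            (energy-image-bound h₁)
            (subst (λ E → N * N ≤ image-size h₂ * E) E₂≡E₁ (energy-image-bound h₂)) sizes low))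
      where
      sizes : image-size h₁ + image-size h₂ ≤ n
      sizes = subst (_≤ n) (∑-distrib-+ (λ z → sgn (count h₁ z)) (λ z → sgn (count h₂ z)))
                (sum-≤-length _ (λ z → sgn-disjoint _ _ (λ both → disjoint (z , both))))

    -- Pairs of equal points have total weight ∑ w² ≤ N.
    diagonal-weight : ∑₄ (λ a b a' b' → w a b * w a' b' * (δ a a' * δ b b')) ≤ N
    diagonal-weight = ∑₂-mono (λ a b → subst (_≤ w a b) (sym (diagonal a b))
      (≤-trans (*-monoʳ-≤ (w a b) (w≤1 a b)) (≤-reflexive (*-identityʳ (w a b)))))
      where
      open +-*-Solver
      diagonal : ∀ a b → ∑₂ (λ a' b' → w a b * w a' b' * (δ a a' * δ b b')) ≡ w a b * w a b
      diagonal a b = begin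
          ∑₂ (λ a' b' → w a b * w a' b' * (δ a a' * δ b b'))
        ≡⟨ ∑₂-cong (λ a' b' → solve 4 (λ x y d e → x :* y :* (d :* e) := x :* y :* e :* d) refl
                                       (w a b) (w a' b') (δ a a') (δ b b')) ⟩
          ∑₂ (λ a' b' → w a b * w a' b' * δ b b' * δ a a')
        ≡⟨ sum-cong-≗ (λ a' → *-distribʳ-sum (δ a a') (λ b' → w a b * w a' b' * δ b b')) ⟨
          sum (λ a' → sum (λ b' → w a b * w a' b' * δ b b') * δ a a')
        ≡⟨ sum-δ (λ a' → sum (λ b' → w a b * w a' b' * δ b b')) a ⟩
          sum (λ b' → w a b * w a b' * δ b b')
        ≡⟨ sum-δ (λ b' → w a b * w a b') b ⟩
          w a b * w a b
        ∎
        where open ≡-Reasoning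

    FewCollisions : ∀ {m n} → (Fin m → GridMap n) → Set
    FewCollisions H = ∀ a b a' b' → (a , b) ≢ (a' , b') → sum (λ ξ → δ (H ξ a b) (H ξ a' b')) ≤ 1

    -- Averaging the energy over such a family of m maps: the energies sum to at
    -- most N² + mN, since only equal points collide more than once.
    energy-average : ∀ {m n} (H : Fin m → GridMap n) → FewCollisions H →
      sum (λ ξ → energy (H ξ)) ≤ m * N + N * N
    energy-average {m} H few = begin
        sum (λ ξ → energy (H ξ))
      ≡⟨ ∑₄-swap (λ ξ a b a' b' → W a b a' b' * δ (H ξ a b) (H ξ a' b')) ⟩
        ∑₄ (λ a b a' b' → sum (λ ξ → W a b a' b' * δ (H ξ a b) (H ξ a' b')))
      ≡⟨ ∑₄-cong (λ a b a' b' → *-distribˡ-sum (W a b a' b') (λ ξ → δ (H ξ a b) (H ξ a' b'))) ⟨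
        ∑₄ (λ a b a' b' → W a b a' b' * sum (λ ξ → δ (H ξ a b) (H ξ a' b')))
      ≤⟨ ∑₄-mono (λ a b a' b' → *-monoʳ-≤ (W a b a' b') (collisions a b a' b')) ⟩
        ∑₄ (λ a b a' b' → W a b a' b' * (1 + m * D a b a' b'))
      ≡⟨ ∑₄-cong (λ a b a' b' → solve 3 (λ x m d → x :* (con 1 :+ m :* d) := x :+ m :* (x :* d)) refl
                                      (W a b a' b') m (D a b a' b')) ⟩
        ∑₄ (λ a b a' b' → W a b a' b' + m * (W a b a' b' * D a b a' b'))
      ≡⟨ ∑₄-+ W (λ a b a' b' → m * (W a b a' b' * D a b a' b')) ⟩
        ∑₄ W + ∑₄ (λ a b a' b' → m * (W a b a' b' * D a b a' b'))
      ≡⟨ cong₂ _+_ (∑₂-product w w) (sym (∑₄-*ˡ m (λ a b a' b' → W a b a' b' * D a b a' b'))) ⟨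
        N * N + m * ∑₄ (λ a b a' b' → W a b a' b' * D a b a' b')
      ≤⟨ +-mono-≤ (≤-refl {N * N}) (*-monoʳ-≤ m diagonal-weight) ⟩
        N * N + m * N
      ≡⟨ +-comm (N * N) (m * N) ⟩
        m * N + N * N
      ∎
      where
      open ≤-Reasoning
      open +-*-Solver
      W D : Fin k → Fin l → Fin k → Fin l → ℕ
      W a b a' b' = w a b * w a' b'
      D a b a' b' = δ a a' * δ b b'
      -- A point collides with itself under all m maps, with any other point at most once.
      collisions : ∀ a b a' b' → sum (λ ξ → δ (H ξ a b) (H ξ a' b')) ≤ 1 + m * D a b a' b'
      collisions a b a' b' with ≡-dec _≟_ _≟_ (a , b) (a' , b')
      ... | yes refl = begin
          sum (λ ξ → δ (H ξ a b) (H ξ a b))  ≤⟨ sum-≤-length _ (λ ξ → δ≤1 _ _) ⟩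
          m                                  ≡⟨ *-identityʳ m ⟨
          m * 1                              ≡⟨ cong (m *_) (cong₂ _*_ (δ-refl a) (δ-refl b)) ⟨
          m * D a b a b                      ≤⟨ m≤n+m _ 1 ⟩
          1 + m * D a b a b                  ∎
      ... | no distinct = ≤-trans (few a b a' b' distinct) (m≤m+n 1 _)

    low-energy-member : ∀ {m n} (H : Fin m → GridMap n) → 0 < m → FewCollisions H →
      ∃ λ ξ → LowEnergy m (H ξ)
    low-energy-member H m>0 few = sum-average (λ ξ → energy (H ξ)) _ m>0 (energy-average H few)

module RingIdentities {c ℓ} (R : CommutativeRing c ℓ) where
  open CommutativeRing R renaming (refl to ≈-refl; sym to ≈-sym; trans to ≈-trans)
  open import Algebra.Properties.Ring ring
    using (-‿distribˡ-*; -‿distribʳ-*; -‿involutive; -‿+-comm; ⁻¹-anti-homo‿-;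
           +-inverseʳ-unique; x≈z//y)
  open import Relation.Binary.Reasoning.Setoid setoid
  open import Algebra.Solver.Ring.NaturalCoefficients.Default commutativeSemiring
    using (solve; _:+_; _:*_; _:=_)

  neg-swap : ∀ x y → - x * y ≈ x * - y
  neg-swap x y = ≈-trans (≈-sym (-‿distribˡ-* x y)) (-‿distribʳ-* x y)

  neg-neg : ∀ x y → - x * - y ≈ x * y
  neg-neg x y = begin
    - x * - y     ≈⟨ neg-swap x (- y) ⟩
    x * - - y     ≈⟨ *-congˡ (-‿involutive y) ⟩
    x * y         ∎

  line-difference : ∀ a₁ b₁ a₂ b₂ ξ →
    (a₂ + ξ * b₂) - (a₁ + ξ * b₁) ≈ (a₂ - a₁) + ξ * (b₂ - b₁)
  line-difference a₁ b₁ a₂ b₂ ξ = begin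
      (a₂ + ξ * b₂) - (a₁ + ξ * b₁)
    ≈⟨ +-congˡ (≈-sym (-‿+-comm a₁ (ξ * b₁))) ⟩
      (a₂ + ξ * b₂) + (- a₁ + - (ξ * b₁))
    ≈⟨ +-congˡ (+-congˡ (-‿distribʳ-* ξ b₁)) ⟩
      (a₂ + ξ * b₂) + (- a₁ + ξ * - b₁)
    ≈⟨ solve 5 (λ a₂ b₂ ξ na₁ nb₁ → (a₂ :+ ξ :* b₂) :+ (na₁ :+ ξ :* nb₁)
                                   := (a₂ :+ na₁) :+ ξ :* (b₂ :+ nb₁))
               ≈-refl a₂ b₂ ξ (- a₁) (- b₁) ⟩
      (a₂ - a₁) + ξ * (b₂ - b₁)
    ∎

  collinear : ∀ {a b a' b' ξ} → a + ξ * b ≈ a' + ξ * b' → ξ * (b' - b) ≈ a - a'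
  collinear {a} {b} {a'} {b'} {ξ} same = begin
      ξ * (b' - b)   ≈⟨ +-inverseʳ-unique (a' - a) (ξ * (b' - b)) vanishes ⟩
      - (a' - a)     ≈⟨ ⁻¹-anti-homo‿- a' a ⟩
      a - a'         ∎
    where
    vanishes : (a' - a) + ξ * (b' - b) ≈ 0#
    vanishes = begin
      (a' - a) + ξ * (b' - b)        ≈⟨ line-difference a b a' b' ξ ⟨
      (a' + ξ * b') - (a + ξ * b)    ≈⟨ +-congʳ same ⟨
      (a + ξ * b) - (a + ξ * b)      ≈⟨ -‿inverseʳ (a + ξ * b) ⟩
      0#                             ∎

  difference-product : ∀ p p' r r' →
    (p - p') * (r - r') ≈ p * r + (p * - r' + (p' * - r + p' * r'))
  difference-product p p' r r' = begin
      (p - p') * (r - r')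
    ≈⟨ solve 4 (λ p np' r nr' → (p :+ np') :* (r :+ nr') := p :* r :+ (p :* nr' :+ (np' :* r :+ np' :* nr')))
               ≈-refl p (- p') r (- r') ⟩
      p * r + (p * - r' + (- p' * r + - p' * - r'))
    ≈⟨ +-congˡ (+-congˡ (+-cong (neg-swap p' r) (neg-neg p' r'))) ⟩
      p * r + (p * - r' + (p' * - r + p' * r'))
    ∎

  -- The key identity: if a + ξb = a' + ξb' and y + (a₁ + ξb₁) = a₂ + ξb₂, then
  -- (b' − b)·y = (a₂ − a₁)(b' − b) + (a − a')(b₂ − b₁) expands into eight
  -- products of the form (point)·(±point).
  eight-products : ∀ {a b a' b' a₁ b₁ a₂ b₂ ξ y} →
    a + ξ * b ≈ a' + ξ * b' → y + (a₁ + ξ * b₁) ≈ a₂ + ξ * b₂ →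
    (b' - b) * y ≈ a₂ * b' + (a₂ * - b + (a₁ * - b' + (a₁ * b +
                   (a * b₂ + (a * - b₁ + (a' * - b₂ + a' * b₁))))))
  eight-products {a} {b} {a'} {b'} {a₁} {b₁} {a₂} {b₂} {ξ} {y} same meet = begin
      (b' - b) * y
    ≈⟨ *-congˡ (≈-trans (x≈z//y y _ _ meet) (line-difference a₁ b₁ a₂ b₂ ξ)) ⟩
      (b' - b) * ((a₂ - a₁) + ξ * (b₂ - b₁))
    ≈⟨ solve 4 (λ u v ξ t → u :* (v :+ ξ :* t) := v :* u :+ (ξ :* u) :* t)
               ≈-refl (b' - b) (a₂ - a₁) ξ (b₂ - b₁) ⟩
      (a₂ - a₁) * (b' - b) + ξ * (b' - b) * (b₂ - b₁)
    ≈⟨ +-congˡ (*-congʳ (collinear same)) ⟩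
      (a₂ - a₁) * (b' - b) + (a - a') * (b₂ - b₁)
    ≈⟨ +-cong (difference-product a₂ a₁ b' b) (difference-product a a' b₂ b₁) ⟩
      (a₂ * b' + (a₂ * - b + (a₁ * - b' + a₁ * b))) + (a * b₂ + (a * - b₁ + (a' * - b₂ + a' * b₁)))
    ≈⟨ solve 8 (λ t₁ t₂ t₃ t₄ t₅ t₆ t₇ t₈ →
                (t₁ :+ (t₂ :+ (t₃ :+ t₄))) :+ (t₅ :+ (t₆ :+ (t₇ :+ t₈)))
                := t₁ :+ (t₂ :+ (t₃ :+ (t₄ :+ (t₅ :+ (t₆ :+ (t₇ :+ t₈)))))))
               ≈-refl (a₂ * b') (a₂ * - b) (a₁ * - b') (a₁ * b)
                      (a * b₂) (a * - b₁) (a' * - b₂) (a' * b₁) ⟩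
      a₂ * b' + (a₂ * - b + (a₁ * - b' + (a₁ * b + (a * b₂ + (a * - b₁ + (a' * - b₂ + a' * b₁))))))
    ∎

module FieldFacts {q : ℕ} (F : FiniteField q) where
  open FiniteField F
  open import Data.Vec.Functional using (_∷_)

  commutativeRing : CommutativeRing _ _
  commutativeRing = record { isCommutativeRing = isCommutativeRing }

  open CommutativeRing commutativeRing using (*-assoc; *-identityʳ; *-comm; +-identityʳ; _-_)
  open import Algebra.Properties.Ring (CommutativeRing.ring commutativeRing)
    using (+-cancelˡ; +-cancelʳ; x∙y⁻¹≈ε⇒x≈y)
  open RingIdentities commutativeRing using (collinear)
  open RingIdentities commutativeRing public using (eight-products)

  divide : ∀ {u} → u ≢ 0# → ∀ x → ∃ λ y → u * y ≡ x
  divide {u} u≢0 x with inverse u u≢0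
  ... | u⁻¹ , uu⁻¹≡1 = x * u⁻¹ , (begin
      u * (x * u⁻¹)   ≡⟨ *-comm u (x * u⁻¹) ⟩
      x * u⁻¹ * u     ≡⟨ *-assoc x u⁻¹ u ⟩
      x * (u⁻¹ * u)   ≡⟨ cong (x *_) (trans (*-comm u⁻¹ u) uu⁻¹≡1) ⟩
      x * 1#          ≡⟨ *-identityʳ x ⟩
      x               ∎)
    where open ≡-Reasoning

  *-cancelʳ-nonzero : ∀ {u s t} → u ≢ 0# → s * u ≡ t * u → s ≡ t
  *-cancelʳ-nonzero {u} {s} {t} u≢0 su≡tu with inverse u u≢0
  ... | u⁻¹ , uu⁻¹≡1 = begin
      s                ≡⟨ cancel s ⟨
      s * u * u⁻¹      ≡⟨ cong (_* u⁻¹) su≡tu ⟩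
      t * u * u⁻¹      ≡⟨ cancel t ⟩
      t                ∎
    where
    open ≡-Reasoning
    cancel : ∀ v → v * u * u⁻¹ ≡ v
    cancel v = trans (*-assoc v u u⁻¹) (trans (cong (v *_) uu⁻¹≡1) (*-identityʳ v))

  difference-nonzero : ∀ {b b'} → b ≢ b' → b' - b ≢ 0#
  difference-nonzero b≢b' b'-b≡0 = b≢b' (sym (x∙y⁻¹≈ε⇒x≈y _ _ b'-b≡0))

  translate-injective : ∀ y {s t} → y + s ≡ y + t → s ≡ t
  translate-injective y = +-cancelˡ y _ _

  collision-separates : ∀ {a b a' b' ξ} → (a , b) ≢ (a' , b') →
    a + ξ * b ≡ a' + ξ * b' → b ≢ b'
  collision-separates {a} {b} {a'} {b'} {ξ} distinct same b≡b' =
    distinct (cong₂ _,_ (+-cancelʳ (ξ * b) a a' same-b) b≡b')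
    where
    same-b : a + ξ * b ≡ a' + ξ * b
    same-b = trans same (cong (λ t → a' + ξ * t) (sym b≡b'))

  -- Two distinct points are identified by (a, b) ↦ a + ξb for at most one ξ:
  -- ξ(b' − b) = a − a' with b' − b ≠ 0 determines ξ.
  distinct-points-meet-once : ∀ {a b a' b' ξ₁ ξ₂} → (a , b) ≢ (a' , b') →
    a + ξ₁ * b ≡ a' + ξ₁ * b' → a + ξ₂ * b ≡ a' + ξ₂ * b' → ξ₁ ≡ ξ₂
  distinct-points-meet-once distinct same₁ same₂ =
    *-cancelʳ-nonzero (difference-nonzero (collision-separates distinct same₁))
                      (trans (collinear same₁) (sym (collinear same₂)))

  InKAB-cons : ∀ {k A B a b s} → a ∈ A → b ∈ B → InKAB F k A B s → InKAB F (suc k) A B (a * b + s)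
  InKAB-cons {a = a} {b} a∈A b∈B (as , bs , as∈A , bs∈B , s≡) =
    a ∷ as , b ∷ bs ,
    (λ { zero → a∈A ; (suc i) → as∈A i }) , (λ { zero → b∈B ; (suc i) → bs∈B i }) ,
    cong (a * b +_) s≡

  InKAB-single : ∀ {A B a b} → a ∈ A → b ∈ B → InKAB F 1 A B (a * b)
  InKAB-single {a = a} {b} a∈A b∈B =
    subst (InKAB F 1 _ _) (+-identityʳ (a * b)) (InKAB-cons a∈A b∈B empty-sum)
    where
    empty-sum : InKAB F 0 _ _ 0#
    empty-sum = (λ ()) , (λ ()) , (λ ()) , (λ ()) , refl

module LineFamily {q : ℕ} (F : FiniteField q) (A B : Subset q) where
  open FiniteField F
  open FieldFacts F
  open Counting using (δ≤1; δ-positive; sum-at-most-one; box; box≤1; box-positive)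
  open Counting.WeightedGrid (box A B) (box≤1 A B) public
    using (N; LowEnergy; pigeonhole; low-energy-member)
  open Counting.WeightedGrid (box A B) (box≤1 A B)
    using (GridMap; Collision; FewCollisions; images-meet; energy-injective; count-witness)

  line : Fin q → GridMap q
  line ξ a b = a + ξ * b

  lines-few-collisions : FewCollisions line
  lines-few-collisions a b a' b' distinct =
    sum-at-most-one _ (λ ξ → δ≤1 _ _) (λ ξ₁ ξ₂ same₁ same₂ →
      distinct-points-meet-once distinct (δ-positive same₁) (δ-positive same₂))

  record Meeting (ξ y : Fin q) : Set where
    field
      a₁ a₂ b₁ b₂ : Fin q
      a₁∈A : a₁ ∈ A
      a₂∈A : a₂ ∈ A
      b₁∈B : b₁ ∈ B
      b₂∈B : b₂ ∈ B
      meet : y + (a₁ + ξ * b₁) ≡ a₂ + ξ * b₂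

  -- If (a, b) ↦ a + ξb has low energy, A + ξB meets each of its translates,
  -- which have the same energy.
  translates-meet : ∀ {ξ} → LowEnergy q (line ξ) → q < N → ∀ y → Meeting ξ y
  translates-meet {ξ} low q<N y
    with images-meet (line ξ) (λ a b → y + line ξ a b)
           (energy-injective (line ξ) (y +_) (translate-injective y)) low q<N
  ... | z , in-image , in-translate
    with count-witness (line ξ) z in-image | count-witness (λ a b → y + line ξ a b) z in-translate
  ... | a₂ , b₂ , w₂>0 , image≡z | a₁ , b₁ , w₁>0 , translate≡z = record
    { a₁∈A = proj₁ (box-positive A B w₁>0) ; b₁∈B = proj₂ (box-positive A B w₁>0)
    ; a₂∈A = proj₁ (box-positive A B w₂>0) ; b₂∈B = proj₂ (box-positive A B w₂>0)
    ; meet = trans translate≡z (sym image≡z) }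

  -- Given a collision a + ξb = a' + ξb' (so b ≠ b') of the low-energy map
  -- (a, b) ↦ a + ξb, every x is u·y with u = b' − b; a meeting
  -- y + (a₁ + ξb₁) = a₂ + ξb₂ then writes x as eight products from AB.
  eight-fold-representation : Symmetric F B → ∀ {ξ} → LowEnergy q (line ξ) → q < N →
    Collision (line ξ) → ∀ x → InKAB F 8 A B x
  eight-fold-representation symB low q<N c x =
    subst (InKAB F 8 A B) (trans (sym (eight-products collide meet)) uy≡x) products
    where
    open Collision c
    a∈A : a ∈ A
    a∈A = proj₁ (box-positive A B weighted)
    b∈B : b ∈ B
    b∈B = proj₂ (box-positive A B weighted)
    a'∈A : a' ∈ A
    a'∈A = proj₁ (box-positive A B weighted')
    b'∈B : b' ∈ B
    b'∈B = proj₂ (box-positive A B weighted')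
    u≢0 : b' + - b ≢ 0#
    u≢0 = difference-nonzero (collision-separates distinct collide)
    y : Fin q
    y = proj₁ (divide u≢0 x)
    uy≡x : (b' + - b) * y ≡ x
    uy≡x = proj₂ (divide u≢0 x)
    open Meeting (translates-meet low q<N y)
    products : InKAB F 8 A B (a₂ * b' + (a₂ * - b + (a₁ * - b' + (a₁ * b +
                              (a * b₂ + (a * - b₁ + (a' * - b₂ + a' * b₁)))))))
    products = InKAB-cons a₂∈A b'∈B (InKAB-cons a₂∈A (symB b b∈B) (InKAB-cons a₁∈A (symB b' b'∈B)
               (InKAB-cons a₁∈A b∈B (InKAB-cons a∈A b₂∈B (InKAB-cons a∈A (symB b₁ b₁∈B)
               (InKAB-cons a'∈A (symB b₂ b₂∈B) (InKAB-single a'∈A b₁∈B)))))))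

open import Data.Nat using (_*_; >-nonZero⁻¹)
open import Data.Fin.Properties using (nonZeroIndex)

theorem8 : (q : ℕ) (F : FiniteField q) (A B : Subset q) →
    Symmetric F B → q < ∣ A ∣ * ∣ B ∣ →
    ∀ (x : Fin q) → InKAB F 8 A B x
theorem8 q F A B symB q<|A||B| x =
  eight-fold-representation symB low q<N (pigeonhole (line ξ) q<N) x
  where
  open LineFamily F A B
  q<N : q < N
  q<N = subst (q <_) (sym (Counting.box-weight A B)) q<|A||B|
  low-energy-direction : ∃ λ ξ → LowEnergy q (line ξ)
  low-energy-direction =
    low-energy-member line (>-nonZero⁻¹ q {{nonZeroIndex x}}) lines-few-collisions
  ξ : Fin q
  ξ = proj₁ low-energy-direction
  low : LowEnergy q (line ξ)
  low = proj₂ low-energy-direction
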